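{- Let $G$ be a finite simple graph with no isolated vertices and degree pair sequence $(d_i,m_i)_{i=1}^n$. Then the independence number of the square $G^2$ of $G$ satisfies $$\alpha(G^2)\geq \sum_{i=1}^n\frac{1}{1+d_im_i}.$$
   Context: For a vertex $i$, $d_i$ is its degree and $m_i=d_i^{ -1}\sum_{j:\, ji\in E(G)} d_j$ is the mean of the degrees of its neighbors. The square $G^2$ has vertex set $V(G)$ and edges $ij$ whenever the distance between $i$ and $j$ in $G$ is $1$ or $2$. $\alpha(H)$ denotes the maximum size of a set of pairwise nonadjacent vertices in $H$. -}

module Defs where

open import Data.Nat as ℕ using (ℕ; zero; suc)
open import Data.Fin using (Fin; zero; suc)
open import Data.Bool using (Bool; true; false)
open import Data.Product using (Σ; ∃; _×_; _,_)
open import Data.Sum using (_⊎_)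
open import Relation.Nullary using (¬_; yes; no)
open import Relation.Binary.PropositionalEquality using (_≡_; _≢_)
open import Data.Integer using (+_)
open import Data.Rational as ℚ using (ℚ; 0ℚ; 1ℚ; _≤_)
open import Data.Rational.Properties using (_≟_)
import Data.Fin.Subset as Sub

record Graph (n : ℕ) : Set where
  field
    adj      : Fin n → Fin n → Bool
    symmetric  : ∀ i j → adj i j ≡ adj j i
    irreflexive : ∀ i → adj i i ≡ false
open Graph public

sumℕ : ∀ {n} → (Fin n → ℕ) → ℕ
sumℕ {zero}  f = 0
sumℕ {suc n} f = f zero ℕ.+ sumℕ (λ i → f (suc i))

sumℚ : ∀ {n} → (Fin n → ℚ) → ℚ
sumℚ {zero}  f = 0ℚ
sumℚ {suc n} f = f zero ℚ.+ sumℚ (λ i → f (suc i))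

indicator : Bool → ℕ
indicator true  = 1
indicator false = 0

degree : ∀ {n} → Graph n → Fin n → ℕ
degree G i = sumℕ (λ j → indicator (adj G i j))

neighbourDegreeSum : ∀ {n} → Graph n → Fin n → ℕ
neighbourDegreeSum G i = sumℕ (λ j → indicator (adj G i j) ℕ.* degree G j)

-- division of a natural by a natural, with the (unused) convention x/0 = 0
_/ℕ_ : ℕ → ℕ → ℚ
x /ℕ zero  = 0ℚ
x /ℕ suc d = (+ x) ℚ./ suc d

-- m_i = d_i^{-1} * sum_{j ~ i} d_j  (only used when d_i ≠ 0)
meanNeighbourDegree : ∀ {n} → Graph n → Fin n → ℚ
meanNeighbourDegree G i = neighbourDegreeSum G i /ℕ degree G i

-- reciprocal with the (unused here) convention 1/0 = 0
inv : ℚ → ℚ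
inv p with p ≟ 0ℚ
... | yes _  = 0ℚ
... | no p≢0 = ℚ.1/_ p {{ℚ.≢-nonZero p≢0}}

NoIsolatedVertices : ∀ {n} → Graph n → Set
NoIsolatedVertices G = ∀ i → degree G i ≢ 0

Adjacent : ∀ {n} → Graph n → Fin n → Fin n → Set
Adjacent G i j = adj G i j ≡ true

AdjSquare : ∀ {n} → Graph n → Fin n → Fin n → Set
AdjSquare G i j = i ≢ j × (Adjacent G i j ⊎ ∃ λ k → Adjacent G i k × Adjacent G k j)

IndependentInSquare : ∀ {n} → Graph n → Sub.Subset n → Set
IndependentInSquare G S = ∀ i j → i Sub.∈ S → j Sub.∈ S → ¬ AdjSquare G i j

AlphaSquareAtLeast : ∀ {n} → Graph n → ℚ → Set
AlphaSquareAtLeast G x = ∃ λ S → IndependentInSquare G S × x ≤ ((+ Sub.∣ S ∣) ℚ./ 1)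

bound : ∀ {n} → Graph n → ℚ
bound G = sumℚ (λ i → inv (1ℚ ℚ.+ ((+ degree G i) ℚ./ 1) ℚ.* meanNeighbourDegree G i))

-- Write sᵥ = dᵥmᵥ = ∑_{k ~ v} d_k for the number of walks v – k – j of length
-- two starting at v, and wᵥ = 1/(1 + sᵥ).  The proof combines two facts.
--
-- 1. Weighted Caro–Wei lemma (module WeightedCaroWei), for any decidable,
--    symmetric, irreflexive relation E on Fin n: if the weights w are
--    nonnegative and |N[v]| · wᵥ ≤ 1 for every closed neighbourhood N[v],
--    then some E-independent set S has ∑ w ≤ |S|.  It is proved greedily:
--    take a remaining vertex v of largest weight into S and delete N[v];
--    the deleted weight is at most |N[v]| · wᵥ ≤ 1.
-- 2. In G², |N[v]| ≤ 1 + sᵥ (module Square): every vertex of N[v] other than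
--    v is a neighbour of v or the end of a walk v – k – j, and the dᵥ walks
--    v – k – v returning to v make room for the dᵥ neighbours.
--
-- Since (1 + sᵥ) · wᵥ = 1, fact 2 gives the hypothesis of fact 1 for G², and
-- the theorem follows.

module Submission where

open import Defs
open import Data.Nat as ℕ using (ℕ; zero; suc; z≤n; s≤s)
import Data.Nat.Properties as ℕP
open import Data.Fin using (Fin; zero; suc)
open import Data.Fin.Properties using (_≟_; any?)
open import Data.Bool using (Bool; true; false; _∨_; _∧_; not; if_then_else_)
open import Data.Bool.Properties using (∧-identityʳ; ∧-zeroʳ; ∨-zeroʳ) renaming (_≟_ to _≟ᵇ_)
open import Data.Product using (∃; _×_; _,_; proj₁; proj₂)
open import Data.Vec using (tabulate)
import Data.Vec.Properties as Vec
import Data.Fin.Subset as Sub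
open import Data.Sum using (_⊎_; inj₁; inj₂)
open import Data.Integer as ℤ using (+_)
import Data.Integer.Properties as ℤP
open import Data.Rational as ℚ using (ℚ; 0ℚ; 1ℚ)
import Data.Rational.Properties as ℚP
import Data.Rational.Unnormalised as ℚᵘ
import Data.Rational.Unnormalised.Properties as ℚᵘP
open import Algebra.Bundles using (CommutativeRing)
import Algebra.Properties.Semiring.Sum as SemiringSum
open import Function using (_∘_)
open import Relation.Binary using (TotalPreorder; Rel; Decidable; Symmetric)
open import Relation.Nullary using (¬_; Dec; does; yes; no; contradiction)
open import Relation.Nullary.Decidable using (dec-true; ¬?; _×-dec_; _⊎-dec_)
open import Data.Empty using (⊥-elim)
open import Relation.Binary.PropositionalEquality

module ℕΣ = SemiringSum ℕP.+-*-semiring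
module ℚΣ = SemiringSum (CommutativeRing.semiring ℚP.+-*-commutativeRing)
open ℕΣ using () renaming (sum to ∑ℕ)
open ℚΣ using () renaming (sum to ∑ℚ)

sumℕ≡∑ℕ : ∀ {n} (f : Fin n → ℕ) → sumℕ f ≡ ∑ℕ f
sumℕ≡∑ℕ {zero}  f = refl
sumℕ≡∑ℕ {suc n} f = cong (f zero ℕ.+_) (sumℕ≡∑ℕ (f ∘ suc))

sumℚ≡∑ℚ : ∀ {n} (f : Fin n → ℚ) → sumℚ f ≡ ∑ℚ f
sumℚ≡∑ℚ {zero}  f = refl
sumℚ≡∑ℚ {suc n} f = cong (f zero ℚ.+_) (sumℚ≡∑ℚ (f ∘ suc))

∑ℕ-mono : ∀ {n} {f g : Fin n → ℕ} → (∀ i → f i ℕ.≤ g i) → ∑ℕ f ℕ.≤ ∑ℕ g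
∑ℕ-mono {zero}  f≤g = z≤n
∑ℕ-mono {suc n} f≤g = ℕP.+-mono-≤ (f≤g zero) (∑ℕ-mono (f≤g ∘ suc))

∑ℚ-mono : ∀ {n} {f g : Fin n → ℚ} → (∀ i → f i ℚ.≤ g i) → ∑ℚ f ℚ.≤ ∑ℚ g
∑ℚ-mono {zero}  f≤g = ℚP.≤-refl
∑ℚ-mono {suc n} f≤g = ℚP.+-mono-≤ (f≤g zero) (∑ℚ-mono (f≤g ∘ suc))

term≤∑ℕ : ∀ {n} (f : Fin n → ℕ) (k : Fin n) → f k ℕ.≤ ∑ℕ f
term≤∑ℕ f zero    = ℕP.m≤m+n (f zero) _
term≤∑ℕ f (suc k) = ℕP.≤-trans (term≤∑ℕ (f ∘ suc) k) (ℕP.m≤n+m _ (f zero))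

∑ℕ-δ : ∀ {n} (v : Fin n) (c : ℕ) → ∑ℕ (λ j → indicator (does (j ≟ v)) ℕ.* c) ≡ c
∑ℕ-δ {suc n} zero    c = begin
  (c ℕ.+ 0) ℕ.+ ∑ℕ (λ (_ : Fin n) → 0) ≡⟨ cong ((c ℕ.+ 0) ℕ.+_) (ℕΣ.sum-replicate-zero n) ⟩
  (c ℕ.+ 0) ℕ.+ 0                       ≡⟨ ℕP.+-identityʳ _ ⟩
  c ℕ.+ 0                               ≡⟨ ℕP.+-identityʳ c ⟩
  c                                     ∎
  where open ≡-Reasoning
∑ℕ-δ {suc n} (suc v) c = ∑ℕ-δ v c

indicator-does : ∀ {p} {P : Set p} (P? : Dec P) {m} → (P → 1 ℕ.≤ m) → indicator (does P?) ℕ.≤ m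
indicator-does (yes p) one≤m = one≤m p
indicator-does (no _)  _     = z≤n

ι : ℕ → ℚ
ι m = (+ m) ℚ./ 1

toℚᵘ-ι : ∀ m → ℚ.toℚᵘ (ι m) ℚᵘ.≃ ℚᵘ.mkℚᵘ (+ m) 0
toℚᵘ-ι m = ℚP.toℚᵘ-fromℚᵘ (ℚᵘ.mkℚᵘ (+ m) 0)

ι-+ : ∀ m k → ι (m ℕ.+ k) ≡ ι m ℚ.+ ι k
ι-+ m k = ℚP.toℚᵘ-injective (begin
    ℚ.toℚᵘ (ι (m ℕ.+ k))                    ≈⟨ toℚᵘ-ι (m ℕ.+ k) ⟩
    ℚᵘ.mkℚᵘ (+ m ℤ.+ + k) 0                 ≈⟨ ℚᵘ.*≡* mkℚᵘ-+ ⟩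
    ℚᵘ.mkℚᵘ (+ m) 0 ℚᵘ.+ ℚᵘ.mkℚᵘ (+ k) 0    ≈⟨ ℚᵘP.+-cong (toℚᵘ-ι m) (toℚᵘ-ι k) ⟨
    ℚ.toℚᵘ (ι m) ℚᵘ.+ ℚ.toℚᵘ (ι k)          ≈⟨ ℚP.toℚᵘ-homo-+ (ι m) (ι k) ⟨
    ℚ.toℚᵘ (ι m ℚ.+ ι k)                    ∎)
  where
  open ℚᵘP.≃-Reasoning
  mkℚᵘ-+ : (+ m ℤ.+ + k) ℤ.* + 1 ≡ (+ m ℤ.* + 1 ℤ.+ + k ℤ.* + 1) ℤ.* + 1
  mkℚᵘ-+ = cong (ℤ._* + 1) (sym (cong₂ ℤ._+_ (ℤP.*-identityʳ (+ m)) (ℤP.*-identityʳ (+ k))))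

ι-*-/ : ∀ d s → ι (suc d) ℚ.* ((+ s) ℚ./ suc d) ≡ ι s
ι-*-/ d s = ℚP.toℚᵘ-injective (begin
    ℚ.toℚᵘ (ι (suc d) ℚ.* ((+ s) ℚ./ suc d))                    ≈⟨ ℚP.toℚᵘ-homo-* (ι (suc d)) _ ⟩
    ℚ.toℚᵘ (ι (suc d)) ℚᵘ.* ℚ.toℚᵘ ((+ s) ℚ./ suc d)            ≈⟨ ℚᵘP.*-cong (toℚᵘ-ι (suc d)) (ℚP.toℚᵘ-fromℚᵘ (ℚᵘ.mkℚᵘ (+ s) d)) ⟩
    ℚᵘ.mkℚᵘ (+ suc d) 0 ℚᵘ.* ℚᵘ.mkℚᵘ (+ s) d                    ≈⟨ ℚᵘ.*≡* cancel ⟩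
    ℚᵘ.mkℚᵘ (+ s) 0                                             ≈⟨ toℚᵘ-ι s ⟨
    ℚ.toℚᵘ (ι s)                                                ∎)
  where
  open ℚᵘP.≃-Reasoning
  cancel : (+ suc d ℤ.* + s) ℤ.* + 1 ≡ + s ℤ.* (+ 1 ℤ.* + suc d)
  cancel = trans (ℤP.*-identityʳ _)
    (trans (ℤP.*-comm (+ suc d) (+ s)) (cong (+ s ℤ.*_) (sym (ℤP.*-identityˡ (+ suc d)))))

ι-nonneg : ∀ m → 0ℚ ℚ.≤ ι m
ι-nonneg m = ℚP.nonNegative⁻¹ (ι m) {{ℚP.normalize-nonNeg m 1}}

ι-mono : ∀ {m k} → m ℕ.≤ k → ι m ℚ.≤ ι k
ι-mono {m} {k} m≤k = begin
  ι m                  ≡⟨ ℚP.+-identityʳ (ι m) ⟨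
  ι m ℚ.+ 0ℚ           ≤⟨ ℚP.+-monoʳ-≤ (ι m) (ι-nonneg (k ℕ.∸ m)) ⟩
  ι m ℚ.+ ι (k ℕ.∸ m)  ≡⟨ ι-+ m (k ℕ.∸ m) ⟨
  ι (m ℕ.+ (k ℕ.∸ m))  ≡⟨ cong ι (ℕP.m+[n∸m]≡n m≤k) ⟩
  ι k                  ∎
  where open ℚP.≤-Reasoning

ι-∑ : ∀ {n} (f : Fin n → ℕ) → ι (∑ℕ f) ≡ ∑ℚ (ι ∘ f)
ι-∑ {zero}  f = refl
ι-∑ {suc n} f = trans (ι-+ (f zero) (∑ℕ (f ∘ suc))) (cong (ι (f zero) ℚ.+_) (ι-∑ (f ∘ suc)))

inv-positive : ∀ p → .{{ℚ.Positive p}} → 0ℚ ℚ.≤ inv p × p ℚ.* inv p ≡ 1ℚ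
inv-positive p with p ℚP.≟ 0ℚ
... | yes p≡0 = ⊥-elim (ℚP.<-irrefl (sym p≡0) (ℚP.positive⁻¹ p))
... | no p≢0  = ℚP.nonNegative⁻¹ 1/p {{ℚP.pos⇒nonNeg 1/p {{ℚP.1/pos⇒pos p}}}}
              , ℚP.*-inverseʳ p {{ℚ.≢-nonZero p≢0}}
  where 1/p = ℚ.1/_ p {{ℚ.≢-nonZero p≢0}}

FinSet : ℕ → Set
FinSet n = Fin n → Bool

module _ {n : ℕ} where

  _∈ᶠ_ : Fin n → FinSet n → Set
  j ∈ᶠ A = A j ≡ true

  _⊆ᶠ_ : FinSet n → FinSet n → Set
  A ⊆ᶠ B = ∀ j → j ∈ᶠ A → j ∈ᶠ B

  _∩_ _∖_ : FinSet n → FinSet n → FinSet n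
  (A ∩ B) j = A j ∧ B j
  (A ∖ B) j = A j ∧ not (B j)

  ⁅_⁆ : Fin n → FinSet n
  ⁅ v ⁆ j = does (j ≟ v)

  insert : Fin n → FinSet n → FinSet n
  insert v A j = does (j ≟ v) ∨ A j

  count : FinSet n → ℕ
  count A = ∑ℕ (indicator ∘ A)

  weight : (Fin n → ℚ) → FinSet n → ℚ
  weight w A = ∑ℚ (λ j → if A j then w j else 0ℚ)

  count-split : ∀ A B → count A ≡ count (A ∖ B) ℕ.+ count (A ∩ B)
  count-split A B = trans (ℕΣ.sum-cong-≗ split) (ℕΣ.∑-distrib-+ (indicator ∘ (A ∖ B)) (indicator ∘ (A ∩ B)))
    where
    split : ∀ j → indicator (A j) ≡ indicator ((A ∖ B) j) ℕ.+ indicator ((A ∩ B) j)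
    split j with A j | B j
    ... | true  | true  = refl
    ... | true  | false = refl
    ... | false | _     = refl

  weight-split : ∀ w A B → weight w A ≡ weight w (A ∖ B) ℚ.+ weight w (A ∩ B)
  weight-split w A B = trans (ℚΣ.sum-cong-≗ split)
    (ℚΣ.∑-distrib-+ (λ j → if (A ∖ B) j then w j else 0ℚ) (λ j → if (A ∩ B) j then w j else 0ℚ))
    where
    split : ∀ j → (if A j then w j else 0ℚ)
                ≡ (if (A ∖ B) j then w j else 0ℚ) ℚ.+ (if (A ∩ B) j then w j else 0ℚ)
    split j with A j | B j
    ... | true  | true  = sym (ℚP.+-identityˡ (w j))
    ... | true  | false = sym (ℚP.+-identityʳ (w j))
    ... | false | _     = sym (ℚP.+-identityˡ 0ℚ)

  count-⁅⁆ : ∀ v → count ⁅ v ⁆ ≡ 1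
  count-⁅⁆ v = trans (ℕΣ.sum-cong-≗ times-one) (∑ℕ-δ v 1)
    where
    times-one : ∀ j → indicator (⁅ v ⁆ j) ≡ indicator (⁅ v ⁆ j) ℕ.* 1
    times-one j = sym (ℕP.*-identityʳ _)

  ∈⇒count-pos : ∀ {A v} → v ∈ᶠ A → 1 ℕ.≤ count A
  ∈⇒count-pos {A} {v} v∈A =
    ℕP.≤-trans (ℕP.≤-reflexive (cong indicator (sym v∈A))) (term≤∑ℕ (indicator ∘ A) v)

  count-∖ : ∀ {A B v} → v ∈ᶠ A → v ∈ᶠ B → suc (count (A ∖ B)) ℕ.≤ count A
  count-∖ {A} {B} {v} v∈A v∈B = begin
    suc (count (A ∖ B))            ≡⟨ ℕP.+-comm 1 _ ⟩
    count (A ∖ B) ℕ.+ 1            ≤⟨ ℕP.+-monoʳ-≤ (count (A ∖ B)) (∈⇒count-pos {A ∩ B} v∈A∩B) ⟩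
    count (A ∖ B) ℕ.+ count (A ∩ B) ≡⟨ count-split A B ⟨
    count A                        ∎
    where
    open ℕP.≤-Reasoning
    v∈A∩B : v ∈ᶠ (A ∩ B)
    v∈A∩B = cong₂ _∧_ v∈A v∈B

  count-insert : ∀ {S v} → S v ≡ false → count (insert v S) ≡ suc (count S)
  count-insert {S} {v} v∉S = begin
    count (insert v S)                                        ≡⟨ count-split (insert v S) ⁅ v ⁆ ⟩
    count (insert v S ∖ ⁅ v ⁆) ℕ.+ count (insert v S ∩ ⁅ v ⁆) ≡⟨ cong₂ ℕ._+_ (ℕΣ.sum-cong-≗ (cong indicator ∘ rest)) (ℕΣ.sum-cong-≗ (cong indicator ∘ new)) ⟩
    count S ℕ.+ count ⁅ v ⁆                                   ≡⟨ cong (count S ℕ.+_) (count-⁅⁆ v) ⟩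
    count S ℕ.+ 1                                             ≡⟨ ℕP.+-comm (count S) 1 ⟩
    suc (count S)                                             ∎
    where
    open ≡-Reasoning
    rest : ∀ j → (insert v S ∖ ⁅ v ⁆) j ≡ S j
    rest j with j ≟ v
    ... | yes refl = sym v∉S
    ... | no _     = ∧-identityʳ (S j)
    new : ∀ j → (insert v S ∩ ⁅ v ⁆) j ≡ ⁅ v ⁆ j
    new j with j ≟ v
    ... | yes _ = refl
    ... | no _  = ∧-zeroʳ (S j)

  weight-∅ : ∀ w {A} → (∀ j → A j ≡ false) → weight w A ≡ 0ℚ
  weight-∅ w {A} A-empty = trans (ℚΣ.sum-cong-≗ zero-term) (ℚΣ.sum-replicate-zero n)
    where
    zero-term : ∀ j → (if A j then w j else 0ℚ) ≡ 0ℚ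
    zero-term j rewrite A-empty j = refl

  ∑-const : ∀ B c → ∑ℚ (λ j → if B j then c else 0ℚ) ≡ ι (count B) ℚ.* c
  ∑-const B c = begin
    ∑ℚ (λ j → if B j then c else 0ℚ)         ≡⟨ ℚΣ.sum-cong-≗ term ⟩
    ∑ℚ (λ j → ι (indicator (B j)) ℚ.* c)     ≡⟨ ℚΣ.*-distribʳ-sum c (ι ∘ indicator ∘ B) ⟨
    ∑ℚ (ι ∘ indicator ∘ B) ℚ.* c             ≡⟨ cong (ℚ._* c) (ι-∑ (indicator ∘ B)) ⟨
    ι (count B) ℚ.* c                        ∎
    where
    open ≡-Reasoning
    term : ∀ j → (if B j then c else 0ℚ) ≡ ι (indicator (B j)) ℚ.* c
    term j with B j
    ... | true  = sym (ℚP.*-identityˡ c)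
    ... | false = sym (ℚP.*-zeroˡ c)

  weight-∩≤ : ∀ w A B {c} → 0ℚ ℚ.≤ c → (∀ j → j ∈ᶠ A → w j ℚ.≤ c) →
              weight w (A ∩ B) ℚ.≤ ι (count B) ℚ.* c
  weight-∩≤ w A B {c} 0≤c w≤c = ℚP.≤-trans (∑ℚ-mono term≤) (ℚP.≤-reflexive (∑-const B c))
    where
    term≤ : ∀ j → (if (A ∩ B) j then w j else 0ℚ) ℚ.≤ (if B j then c else 0ℚ)
    term≤ j with A j in j∈A | B j
    ... | true  | true  = w≤c j j∈A
    ... | true  | false = ℚP.≤-refl
    ... | false | true  = 0≤c
    ... | false | false = ℚP.≤-refl

  ∈∖⇒∈ : ∀ {A B j} → j ∈ᶠ (A ∖ B) → j ∈ᶠ A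
  ∈∖⇒∈ {A} {B} {j} j∈A∖B with A j
  ... | true = refl

  ∈∖⇒∉ : ∀ {A B j} → j ∈ᶠ (A ∖ B) → B j ≡ false
  ∈∖⇒∉ {A} {B} {j} j∈A∖B with A j | B j
  ... | true | false = refl

count-tabulate : ∀ {n} (A : FinSet n) → Sub.∣ tabulate A ∣ ≡ count A
count-tabulate {zero}  A = refl
count-tabulate {suc n} A with A zero
... | true  = cong suc (count-tabulate (A ∘ suc))
... | false = count-tabulate (A ∘ suc)

∈-tabulate : ∀ {n} {A : FinSet n} {i} → i Sub.∈ tabulate A → i ∈ᶠ A
∈-tabulate {A = A} {i} i∈ = trans (sym (Vec.lookup∘tabulate A i)) (Vec.[]=⇒lookup i∈)

module _ {c ℓ₁ ℓ₂} (O : TotalPreorder c ℓ₁ ℓ₂) where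
  open TotalPreorder O using (Carrier; _≲_; total) renaming (refl to ≲-refl; trans to ≲-trans)

  heaviest : ∀ {n} (A : FinSet n) (f : Fin n → Carrier) →
             (∀ j → A j ≡ false) ⊎ (∃ λ v → v ∈ᶠ A × (∀ u → u ∈ᶠ A → f u ≲ f v))
  heaviest {zero}  A f = inj₁ λ ()
  heaviest {suc n} A f with A zero in A0 | heaviest (A ∘ suc) (f ∘ suc)
  ... | false | inj₁ empty = inj₁ λ { zero → A0 ; (suc j) → empty j }
  ... | false | inj₂ (v , v∈A , max) =
    inj₂ (suc v , v∈A , λ { zero 0∈A → contradiction (trans (sym 0∈A) A0) λ () ; (suc u) u∈A → max u u∈A })
  ... | true | inj₁ empty =
    inj₂ (zero , A0 , λ { zero _ → ≲-refl ; (suc u) u∈A → contradiction (trans (sym u∈A) (empty u)) λ () })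
  ... | true | inj₂ (v , v∈A , max) with total (f zero) (f (suc v))
  ...   | inj₁ f0≲fv = inj₂ (suc v , v∈A , λ { zero _ → f0≲fv ; (suc u) u∈A → max u u∈A })
  ...   | inj₂ fv≲f0 = inj₂ (zero , A0 , λ { zero _ → ≲-refl ; (suc u) u∈A → ≲-trans (max u u∈A) fv≲f0 })

module WeightedCaroWei {n ℓ} {E : Rel (Fin n) ℓ}
  (E? : Decidable E) (E-sym : Symmetric E) (E-irrefl : ∀ v → ¬ E v v) where

  N[_] : Fin n → FinSet n
  N[ v ] j = does (j ≟ v) ∨ does (E? v j)

  Independent : FinSet n → Set ℓ
  Independent S = ∀ i j → i ∈ᶠ S → j ∈ᶠ S → ¬ E i j

  v∈N[v] : ∀ v → v ∈ᶠ N[ v ]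
  v∈N[v] v rewrite dec-true (v ≟ v) refl = refl

  E⇒∈N : ∀ {v j} → E v j → j ∈ᶠ N[ v ]
  E⇒∈N {v} {j} Evj rewrite dec-true (E? v j) Evj = ∨-zeroʳ (does (j ≟ v))

  insert-independent : ∀ {S v} → Independent S → (∀ j → j ∈ᶠ S → N[ v ] j ≡ false) →
                       Independent (insert v S)
  insert-independent {S} {v} S-ind S-avoids i j i∈ j∈ Eij with i ≟ v | j ≟ v
  ... | yes refl | yes refl = E-irrefl v Eij
  ... | yes refl | no _     = contradiction (trans (sym (E⇒∈N Eij)) (S-avoids j j∈)) λ ()
  ... | no _     | yes refl = contradiction (trans (sym (E⇒∈N (E-sym Eij))) (S-avoids i i∈)) λ ()
  ... | no _     | no _     = S-ind i j i∈ j∈ Eij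

  module _ (w : Fin n → ℚ) (w≥0 : ∀ v → 0ℚ ℚ.≤ w v)
           (budget : ∀ v → ι (count N[ v ]) ℚ.* w v ℚ.≤ 1ℚ) where

    delete-heaviest : ∀ {A v} → (∀ u → u ∈ᶠ A → w u ℚ.≤ w v) →
                      weight w A ℚ.≤ weight w (A ∖ N[ v ]) ℚ.+ 1ℚ
    delete-heaviest {A} {v} v-max = begin
      weight w A                                           ≡⟨ weight-split w A N[ v ] ⟩
      weight w (A ∖ N[ v ]) ℚ.+ weight w (A ∩ N[ v ])      ≤⟨ ℚP.+-monoʳ-≤ (weight w (A ∖ N[ v ])) (weight-∩≤ w A N[ v ] (w≥0 v) v-max) ⟩
      weight w (A ∖ N[ v ]) ℚ.+ ι (count N[ v ]) ℚ.* w v   ≤⟨ ℚP.+-monoʳ-≤ (weight w (A ∖ N[ v ])) (budget v) ⟩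
      weight w (A ∖ N[ v ]) ℚ.+ 1ℚ                         ∎
      where open ℚP.≤-Reasoning

    -- The greedy algorithm, run on A: repeatedly take a heaviest remaining
    -- element and delete its closed neighbourhood.  Recursion is on an
    -- upper bound k for the size of A.
    greedy : ∀ k A → count A ℕ.< k →
             ∃ λ S → S ⊆ᶠ A × Independent S × weight w A ℚ.≤ ι (count S)
    greedy (suc k) A |A|<k with heaviest ℚP.≤-totalPreorder A w
    ... | inj₁ A-empty = (λ _ → false) , (λ _ ()) , (λ _ _ ()) ,
                         ℚP.≤-trans (ℚP.≤-reflexive (weight-∅ w A-empty)) (ι-nonneg (count {n} (λ _ → false)))
    ... | inj₂ (v , v∈A , v-max) with greedy k (A ∖ N[ v ]) smaller
      where
      smaller : count (A ∖ N[ v ]) ℕ.< k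
      smaller = ℕP.≤-trans (count-∖ {A = A} {B = N[ v ]} v∈A (v∈N[v] v)) (ℕ.s≤s⁻¹ |A|<k)
    ... | S , S⊆ , S-ind , S-heavy = insert v S , insert⊆A , insert-independent S-ind S-avoids , heavy
      where
      S-avoids : ∀ j → j ∈ᶠ S → N[ v ] j ≡ false
      S-avoids j j∈S = ∈∖⇒∉ {A = A} {B = N[ v ]} (S⊆ j j∈S)

      v∉S : S v ≡ false
      v∉S with S v in v∈S
      ... | false = refl
      ... | true  = contradiction (trans (sym (v∈N[v] v)) (S-avoids v v∈S)) λ ()

      insert⊆A : insert v S ⊆ᶠ A
      insert⊆A j j∈ with j ≟ v
      ... | yes refl = v∈A
      ... | no _     = ∈∖⇒∈ {A = A} {B = N[ v ]} (S⊆ j j∈)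

      heavy : weight w A ℚ.≤ ι (count (insert v S))
      heavy = begin
        weight w A                     ≤⟨ delete-heaviest v-max ⟩
        weight w (A ∖ N[ v ]) ℚ.+ 1ℚ   ≤⟨ ℚP.+-monoˡ-≤ 1ℚ S-heavy ⟩
        ι (count S) ℚ.+ ι 1            ≡⟨ ι-+ (count S) 1 ⟨
        ι (count S ℕ.+ 1)              ≡⟨ cong ι (ℕP.+-comm (count S) 1) ⟩
        ι (suc (count S))              ≡⟨ cong ι (count-insert {S = S} v∉S) ⟨
        ι (count (insert v S))         ∎
        where open ℚP.≤-Reasoning

    caroWei : ∃ λ S → Independent S × ∑ℚ w ℚ.≤ ι (count S)
    caroWei with greedy (suc (count everything)) everything (ℕP.n<1+n _)
      where
      everything : FinSet n
      everything _ = true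
    ... | S , _ , S-ind , heavy = S , S-ind , heavy

module Square {n : ℕ} (G : Graph n) where

  a : Fin n → Fin n → ℕ
  a i j = indicator (adj G i j)

  adjacent? : Decidable (Adjacent G)
  adjacent? i j = adj G i j ≟ᵇ true

  adjSquare? : Decidable (AdjSquare G)
  adjSquare? i j = ¬? (i ≟ j) ×-dec (adjacent? i j ⊎-dec any? λ k → adjacent? i k ×-dec adjacent? k j)

  adjSquare-sym : Symmetric (AdjSquare G)
  adjSquare-sym (i≢j , inj₁ ij)             = i≢j ∘ sym , inj₁ (trans (symmetric G _ _) ij)
  adjSquare-sym (i≢j , inj₂ (k , ik , kj)) =
    i≢j ∘ sym , inj₂ (k , trans (symmetric G _ k) kj , trans (symmetric G k _) ik)

  adjSquare-irrefl : ∀ v → ¬ AdjSquare G v v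
  adjSquare-irrefl v (v≢v , _) = v≢v refl

  open WeightedCaroWei adjSquare? adjSquare-sym adjSquare-irrefl public

  walks₂ : Fin n → Fin n → ℕ
  walks₂ v j = ∑ℕ (λ k → a v k ℕ.* a k j)

  walks₂-closed : ∀ v → walks₂ v v ≡ degree G v
  walks₂-closed v = trans (ℕΣ.sum-cong-≗ back) (sym (sumℕ≡∑ℕ (a v)))
    where
    idempotent : ∀ b → indicator b ℕ.* indicator b ≡ indicator b
    idempotent true  = refl
    idempotent false = refl
    back : ∀ k → a v k ℕ.* a k v ≡ a v k
    back k = trans (cong (λ b → a v k ℕ.* indicator b) (symmetric G k v)) (idempotent (adj G v k))

  ∑walks₂ : ∀ v → ∑ℕ (walks₂ v) ≡ neighbourDegreeSum G v
  ∑walks₂ v = begin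
    ∑ℕ (λ j → ∑ℕ (λ k → a v k ℕ.* a k j))  ≡⟨ ℕΣ.∑-comm (λ j k → a v k ℕ.* a k j) ⟩
    ∑ℕ (λ k → ∑ℕ (λ j → a v k ℕ.* a k j))  ≡⟨ ℕΣ.sum-cong-≗ (λ k → ℕΣ.*-distribˡ-sum (a v k) (a k)) ⟨
    ∑ℕ (λ k → a v k ℕ.* ∑ℕ (a k))          ≡⟨ ℕΣ.sum-cong-≗ (λ k → cong (a v k ℕ.*_) (sumℕ≡∑ℕ (a k))) ⟨
    ∑ℕ (λ k → a v k ℕ.* degree G k)        ≡⟨ sumℕ≡∑ℕ (λ k → a v k ℕ.* degree G k) ⟨
    neighbourDegreeSum G v                 ∎
    where open ≡-Reasoning

  -- Every j ≠ v in N[v] is a neighbour of v or the end of a walk v – k – j,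
  -- while v itself is the end of d_v such walks.
  N[v]-pointwise : ∀ v j →
    indicator (N[ v ] j) ℕ.+ indicator (does (j ≟ v)) ℕ.* degree G v
      ℕ.≤ indicator (does (j ≟ v)) ℕ.* 1 ℕ.+ (a v j ℕ.+ walks₂ v j)
  N[v]-pointwise v j with j ≟ v
  ... | yes refl rewrite irreflexive G v | walks₂-closed v = s≤s (ℕP.≤-reflexive (ℕP.+-identityʳ _))
  ... | no _ = ℕP.≤-trans (ℕP.≤-reflexive (ℕP.+-identityʳ _)) (indicator-does (adjSquare? v j) witness)
    where
    witness : AdjSquare G v j → 1 ℕ.≤ a v j ℕ.+ walks₂ v j
    witness (_ , inj₁ vj)            = ℕP.≤-trans (ℕP.≤-reflexive (cong indicator (sym vj))) (ℕP.m≤m+n (a v j) _)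
    witness (_ , inj₂ (k , vk , kj)) = ℕP.≤-trans walk (ℕP.m≤n+m (walks₂ v j) (a v j))
      where
      walk : 1 ℕ.≤ walks₂ v j
      walk = ℕP.≤-trans (ℕP.≤-reflexive (sym (cong₂ (λ x y → indicator x ℕ.* indicator y) vk kj)))
                        (term≤∑ℕ (λ k → a v k ℕ.* a k j) k)

  count-N[v] : ∀ v → count N[ v ] ℕ.≤ suc (neighbourDegreeSum G v)
  count-N[v] v = ℕP.+-cancelˡ-≤ (degree G v) _ _ (begin
    degree G v ℕ.+ count N[ v ]                                ≡⟨ ℕP.+-comm (degree G v) _ ⟩
    count N[ v ] ℕ.+ degree G v                                ≡⟨ cong (count N[ v ] ℕ.+_) (∑ℕ-δ v (degree G v)) ⟨
    count N[ v ] ℕ.+ ∑ℕ (λ j → δ j ℕ.* degree G v)             ≡⟨ ℕΣ.∑-distrib-+ (indicator ∘ N[ v ]) (λ j → δ j ℕ.* degree G v) ⟨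
    ∑ℕ (λ j → indicator (N[ v ] j) ℕ.+ δ j ℕ.* degree G v)     ≤⟨ ∑ℕ-mono (N[v]-pointwise v) ⟩
    ∑ℕ (λ j → δ j ℕ.* 1 ℕ.+ (a v j ℕ.+ walks₂ v j))            ≡⟨ ℕΣ.∑-distrib-+ (λ j → δ j ℕ.* 1) (λ j → a v j ℕ.+ walks₂ v j) ⟩
    ∑ℕ (λ j → δ j ℕ.* 1) ℕ.+ ∑ℕ (λ j → a v j ℕ.+ walks₂ v j)   ≡⟨ cong₂ ℕ._+_ (∑ℕ-δ v 1) (ℕΣ.∑-distrib-+ (a v) (walks₂ v)) ⟩
    1 ℕ.+ (∑ℕ (a v) ℕ.+ ∑ℕ (walks₂ v))                         ≡⟨ cong (λ x → 1 ℕ.+ (x ℕ.+ ∑ℕ (walks₂ v))) (sumℕ≡∑ℕ (a v)) ⟨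
    1 ℕ.+ (degree G v ℕ.+ ∑ℕ (walks₂ v))                       ≡⟨ cong (λ x → 1 ℕ.+ (degree G v ℕ.+ x)) (∑walks₂ v) ⟩
    1 ℕ.+ (degree G v ℕ.+ neighbourDegreeSum G v)              ≡⟨ ℕP.+-suc (degree G v) _ ⟨
    degree G v ℕ.+ suc (neighbourDegreeSum G v)                ∎)
    where
    open ℕP.≤-Reasoning
    δ : Fin n → ℕ
    δ j = indicator (does (j ≟ v))

vertex-weight : ∀ d s → d ≢ 0 →
  let w = inv (1ℚ ℚ.+ ι d ℚ.* (s /ℕ d)) in 0ℚ ℚ.≤ w × ι (suc s) ℚ.* w ≡ 1ℚ
vertex-weight zero    s d≢0 = contradiction refl d≢0
vertex-weight (suc d) s _   =
  subst (λ p → 0ℚ ℚ.≤ inv p × ι (suc s) ℚ.* inv p ≡ 1ℚ) (sym one+d·s/d)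
        (inv-positive (ι (suc s)) {{ℚP.normalize-pos (suc s) 1}})
  where
  one+d·s/d : 1ℚ ℚ.+ ι (suc d) ℚ.* ((+ s) ℚ./ suc d) ≡ ι (suc s)
  one+d·s/d = trans (cong (1ℚ ℚ.+_) (ι-*-/ d s)) (sym (ι-+ 1 s))

squareWeight : ∀ {n} → Graph n → Fin n → ℚ
squareWeight G i = inv (1ℚ ℚ.+ ι (degree G i) ℚ.* meanNeighbourDegree G i)

module _ {n : ℕ} (G : Graph n) (no-isolated : NoIsolatedVertices G) where
  open Square G

  squareWeight-spec : ∀ i → 0ℚ ℚ.≤ squareWeight G i × ι (suc (neighbourDegreeSum G i)) ℚ.* squareWeight G i ≡ 1ℚ
  squareWeight-spec i = vertex-weight (degree G i) (neighbourDegreeSum G i) (no-isolated i)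

  squareWeight-budget : ∀ v → ι (count N[ v ]) ℚ.* squareWeight G v ℚ.≤ 1ℚ
  squareWeight-budget v = begin
    ι (count N[ v ]) ℚ.* squareWeight G v                    ≤⟨ ℚP.*-monoʳ-≤-nonNeg (squareWeight G v) {{w≥0}} (ι-mono (count-N[v] v)) ⟩
    ι (suc (neighbourDegreeSum G v)) ℚ.* squareWeight G v    ≡⟨ proj₂ (squareWeight-spec v) ⟩
    1ℚ                                                       ∎
    where
    open ℚP.≤-Reasoning
    w≥0 : ℚ.NonNegative (squareWeight G v)
    w≥0 = ℚ.nonNegative (proj₁ (squareWeight-spec v))

alphaSquare-witness : ∀ {n} (G : Graph n) {x} (S : FinSet n) →
                      Square.Independent G S → x ℚ.≤ ι (count S) → AlphaSquareAtLeast G x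
alphaSquare-witness G {x} S S-independent x≤|S| =
  tabulate S , independent , subst (x ℚ.≤_) (cong ι (sym (count-tabulate S))) x≤|S|
  where
  independent : IndependentInSquare G (tabulate S)
  independent i j i∈S j∈S = S-independent i j (∈-tabulate i∈S) (∈-tabulate j∈S)

proposition3p1 : (n : ℕ) (G : Graph n) → NoIsolatedVertices G → AlphaSquareAtLeast G (bound G)
proposition3p1 n G no-isolated =
  let S , S-independent , heavy = Square.caroWei G (squareWeight G) (proj₁ ∘ squareWeight-spec G no-isolated)
                                                   (squareWeight-budget G no-isolated)
  in alphaSquare-witness G S S-independent (subst (ℚ._≤ ι (count S)) (sym (sumℚ≡∑ℚ (squareWeight G))) heavy)
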